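{- Let $X$ be a metric space with a distinguished point $a_0\in X$ and let $(Y,\phi)$ be a minimal S-extension of $X$. Then $Y$ is homogeneous, i.e. for all $y_1,y_2\in Y$ there is an isometry of $Y$ mapping $y_2$ to $y_1$.
   Context: $\mathcal{P}_X$ is the set of partial isometries (isometries between finite subsets) of $X$ not contained in the identity. An S-extension of $X$ is a pair $(Y,\phi)$ where $Y$ is a metric space extending $X$ ($X\subseteq Y$, $d_Y\restriction X=d_X$) and $\phi:\mathcal{P}_X\to\mathrm{Iso}(Y)$ satisfies $\phi(p)\restriction\mathrm{dom}(p)=p$; assuming $\phi(p^{ -1})=\phi(p)^{ -1}$, $\phi$ is extended to a group homomorphism from the free group $\mathbb{F}(\mathcal{P}_X)$ (with $p^{ -1}$ identified with the formal inverse of $p$) to $\mathrm{Iso}(Y)$. $(Y,\phi)$ is minimal if for every $y\in Y$ there is $g\in\mathbb{F}(\mathcal{P}_X)$ with $y=\phi(g)(a_0)$. -}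

module Defs where

open import Data.Product using (Σ; ∃; _×_; _,_; proj₁; proj₂)
open import Data.List using (List; []; _∷_; map)
open import Data.List.Membership.Propositional using (_∈_)
open import Relation.Binary.PropositionalEquality using (_≡_)
open import Relation.Nullary using (¬_)
open import Function using (_⇔_)

record DistValues : Set₁ where
  field
    Val : Set
    0#  : Val
    _+_ : Val → Val → Val
    _≤_ : Val → Val → Set

record MetricSpace (V : DistValues) : Set₁ where
  open DistValues V
  field
    Pt    : Set
    d     : Pt → Pt → Val
    nonneg : ∀ x y → 0# ≤ d x y
    d≡0⇔  : ∀ x y → (d x y ≡ 0# ⇔ x ≡ y)
    sym   : ∀ x y → d x y ≡ d y x
    tri   : ∀ x y z → d x z ≤ (d x y + d y z)

module _ {V : DistValues} where
  open MetricSpace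

  -- A partial isometry of X between finite subsets, given by its (finite)
  -- graph, a list of pairs (a , p a).  Being distance preserving on the
  -- graph (together with the metric axioms) makes it a well-defined
  -- injective map from the finite set of first coordinates onto the finite
  -- set of second coordinates.  Membership in 𝒫_X also requires that p is
  -- not contained in the identity: some pair (a , b) with a ≢ b.
  record PartialIso (X : MetricSpace V) : Set where
    field
      graph    : List (Pt X × Pt X)
      isometric : ∀ {a b a' b'} → (a , b) ∈ graph → (a' , b') ∈ graph →
                  d X b b' ≡ d X a a'
      notId    : Σ (Pt X × Pt X) λ ab → (ab ∈ graph) × ¬ (proj₁ ab ≡ proj₂ ab)


  IsInverseOf : {X : MetricSpace V} → PartialIso X → PartialIso X → Set
  IsInverseOf {X} q p = ∀ (a b : Pt X) →
    ((a , b) ∈ PartialIso.graph q ⇔ (b , a) ∈ PartialIso.graph p)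

  record Isometry (Y : MetricSpace V) : Set where
    field
      fun   : Pt Y → Pt Y
      inv   : Pt Y → Pt Y
      fun∘inv : ∀ y → fun (inv y) ≡ y
      inv∘fun : ∀ y → inv (fun y) ≡ y
      preserves : ∀ y y' → d Y (fun y) (fun y') ≡ d Y y y'

  -- X ⊆ Y is witnessed by a distance
  -- preserving embedding ι.  φ(p) extends p, and φ(p⁻¹) = φ(p)⁻¹
  -- (this also forces φ to depend only on the partial isometry, not on
  -- the listing of its graph).
  record SExtension (X Y : MetricSpace V) : Set where
    field
      ι       : Pt X → Pt Y
      ι-isom  : ∀ x x' → d Y (ι x) (ι x') ≡ d X x x'
      φ       : PartialIso X → Isometry Y
      extends : ∀ p {a b} → (a , b) ∈ PartialIso.graph p →
                Isometry.fun (φ p) (ι a) ≡ ι b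
      φ-inv   : ∀ p q → IsInverseOf q p →
                ∀ y → Isometry.fun (φ q) y ≡ Isometry.inv (φ p) y

  -- The extension of φ to the free group 𝔽(𝒫_X) (with p⁻¹ identified with
  -- the formal inverse of p): every element is a word p₁ ⋯ pₙ over 𝒫_X,
  -- acting by φ(p₁) ∘ ⋯ ∘ φ(pₙ).
  act : {X Y : MetricSpace V} → SExtension X Y → List (PartialIso X) → Pt Y → Pt Y
  act E []      y = y
  act E (p ∷ w) y = Isometry.fun (SExtension.φ E p) (act E w y)

  Minimal : {X Y : MetricSpace V} → SExtension X Y → Pt X → Set
  Minimal {X} {Y} E a₀ = ∀ (y : Pt Y) →
    Σ (List (PartialIso X)) λ g → y ≡ act E g (SExtension.ι E a₀)

  Homogeneous : MetricSpace V → Set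
  Homogeneous Y = ∀ (y₁ y₂ : Pt Y) →
    Σ (Isometry Y) λ f → Isometry.fun f y₂ ≡ y₁

module Submission where

open import Defs
open import Data.Product using (Σ; _,_)
open import Data.List using (List; []; _∷_)
open import Function using (_∘′_)
open import Relation.Binary.PropositionalEquality
  using (_≡_; refl; sym; trans; cong; cong₂; module ≡-Reasoning)

-- Minimality says Y is a single orbit of the group of isometries φ(𝔽(𝒫_X)):
-- if yᵢ = φ(gᵢ)(a₀), then φ(g₁ g₂⁻¹) maps y₂ to y₁.

module _ {V : DistValues} {Y : MetricSpace V} where
  open MetricSpace Y using (Pt; d)
  open Isometry

  idᴵ : Isometry Y
  idᴵ = record
    { fun = λ y → y ; inv = λ y → y
    ; fun∘inv = λ _ → refl ; inv∘fun = λ _ → refl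
    ; preserves = λ _ _ → refl
    }

  _∘ᴵ_ : Isometry Y → Isometry Y → Isometry Y
  f ∘ᴵ g = record
    { fun = λ y → fun f (fun g y)
    ; inv = λ y → inv g (inv f y)
    ; fun∘inv = λ y → trans (cong (fun f) (fun∘inv g (inv f y))) (fun∘inv f y)
    ; inv∘fun = λ y → trans (cong (inv g) (inv∘fun f (fun g y))) (inv∘fun g y)
    ; preserves = λ y y' → trans (preserves f (fun g y) (fun g y')) (preserves g y y')
    }

  inv-preserves : (f : Isometry Y) → ∀ y y' → d (inv f y) (inv f y') ≡ d y y'
  inv-preserves f y y' = begin
    d (inv f y) (inv f y')               ≡⟨ sym (preserves f (inv f y) (inv f y')) ⟩
    d (fun f (inv f y)) (fun f (inv f y')) ≡⟨ cong₂ d (fun∘inv f y) (fun∘inv f y') ⟩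
    d y y'                               ∎
    where open ≡-Reasoning

  _⁻¹ᴵ : Isometry Y → Isometry Y
  f ⁻¹ᴵ = record
    { fun = inv f ; inv = fun f
    ; fun∘inv = inv∘fun f ; inv∘fun = fun∘inv f
    ; preserves = inv-preserves f
    }

  homogeneous-if-orbit : (z : Pt) →
    (∀ y → Σ (Isometry Y) λ g → fun g z ≡ y) → Homogeneous Y
  homogeneous-if-orbit z orbit y₁ y₂ with orbit y₁ | orbit y₂
  ... | g₁ , g₁z≡y₁ | g₂ , g₂z≡y₂ = g₁ ∘ᴵ (g₂ ⁻¹ᴵ) , (begin
    fun g₁ (inv g₂ y₂)          ≡⟨ cong (fun g₁ ∘′ inv g₂) (sym g₂z≡y₂) ⟩
    fun g₁ (inv g₂ (fun g₂ z))  ≡⟨ cong (fun g₁) (inv∘fun g₂ z) ⟩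
    fun g₁ z                    ≡⟨ g₁z≡y₁ ⟩
    y₁                          ∎)
    where open ≡-Reasoning

module _ {V : DistValues} {X Y : MetricSpace V} (E : SExtension X Y) where
  open SExtension E using (φ)

  wordIsometry : List (PartialIso X) → Isometry Y
  wordIsometry []      = idᴵ
  wordIsometry (p ∷ w) = φ p ∘ᴵ wordIsometry w

  wordIsometry-fun : ∀ w y → Isometry.fun (wordIsometry w) y ≡ act E w y
  wordIsometry-fun []      y = refl
  wordIsometry-fun (p ∷ w) y = cong (Isometry.fun (φ p)) (wordIsometry-fun w y)

lemma7p1 : (V : DistValues) (X : MetricSpace V) (a₀ : MetricSpace.Pt X)
           (Y : MetricSpace V) (E : SExtension X Y) →
           Minimal E a₀ → Homogeneous Y
lemma7p1 V X a₀ Y E minimal = homogeneous-if-orbit (SExtension.ι E a₀) orbit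
  where
  orbit : ∀ y → Σ (Isometry Y) λ g → Isometry.fun g (SExtension.ι E a₀) ≡ y
  orbit y with minimal y
  ... | w , y≡wa₀ = wordIsometry E w , trans (wordIsometry-fun E w _) (sym y≡wa₀)
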